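{- Let $q$ be a power of an odd prime and let $C$ be a Golomb-Costas array of order $q-2$, with $\#(e,e)$, $\#(o,o)$, $\#(e,o)$, $\#(o,e)$ its numbers of even/even, odd/odd, even/odd and odd/even dots. If $q\equiv 1\pmod 4$, then $\#(e,e)=(q-5)/4$ and $\#(o,o)=\#(e,o)=\#(o,e)=(q-1)/4$. If $q\equiv 3\pmod 4$, then $\#(e,e)=\#(e,o)=\#(o,e)=(q-3)/4$ and $\#(o,o)=(q+1)/4$.
   Context: $\mathbb{F}_q$ is the finite field with $q$ elements and $\mathbb{F}_q^*$ its cyclic multiplicative group. Given generators $\alpha,\beta$ of $\mathbb{F}_q^*$ (possibly $\alpha=\beta$), the Golomb-Costas array of order $q-2$ is the $(q-2)\times(q-2)$ array with a dot in position $(i,j)$ (row $i$, column $j$, $1\le i,j\le q-2$) exactly when $\alpha^i+\beta^j=1$. A dot in row $i$, column $j$ is even/even if $i,j$ are both even, odd/odd if both are odd, even/odd if $i$ is even and $j$ odd, odd/even if $i$ is odd and $j$ even. -}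

module Defs where

open import Level using (0ℓ)
open import Algebra.Bundles using (CommutativeRing)
open import Data.Nat using (ℕ; zero; suc; _∸_; _%_)
open import Data.Nat.Properties using () renaming (_≟_ to _≟ℕ_)
open import Data.Fin using (Fin)
open import Data.Product using (∃; _×_; _,_)
open import Data.List using (List; length; filter; map; upTo; cartesianProduct)
open import Relation.Nullary using (¬_; Dec)
open import Relation.Nullary.Decidable using (_×-dec_)
open import Relation.Binary using (Decidable)
open import Relation.Binary.PropositionalEquality using (_≡_)

record FiniteField (q : ℕ) : Set₁ where
  field
    cring : CommutativeRing 0ℓ 0ℓ
  open CommutativeRing cring public
  field
    _≟_      : Decidable _≈_
    0≉1      : ¬ (0# ≈ 1#)
    inverse  : ∀ x → ¬ (x ≈ 0#) → ∃ λ y → x * y ≈ 1#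
    toFin    : Carrier → Fin q
    fromFin  : Fin q → Carrier
    toFin-cong     : ∀ {x y} → x ≈ y → toFin x ≡ toFin y
    from∘to        : ∀ x → fromFin (toFin x) ≈ x
    to∘from        : ∀ i → toFin (fromFin i) ≡ i

module _ {q : ℕ} (F : FiniteField q) where
  open FiniteField F

  pow : Carrier → ℕ → Carrier
  pow x zero    = 1#
  pow x (suc n) = x * pow x n

  IsGenerator : Carrier → Set
  IsGenerator α = ¬ (α ≈ 0#) × (∀ x → ¬ (x ≈ 0#) → ∃ λ i → pow α i ≈ x)

  indices : List ℕ
  indices = map suc (upTo (q ∸ 2))

  -- Number of dots (i,j), 1 ≤ i,j ≤ q-2, of the Golomb-Costas array
  -- (α^i + β^j = 1) with i % 2 ≡ a and j % 2 ≡ b  (0 = even, 1 = odd).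
  dotCount : (α β : Carrier) (a b : ℕ) → ℕ
  dotCount α β a b =
    length (filter (λ { (i , j) → ((i % 2) ≟ℕ a) ×-dec (((j % 2) ≟ℕ b)
                        ×-dec ((pow α i + pow β j) ≟ 1#)) })
                   (cartesianProduct indices indices))

module Submission where

-- Let χ : F → ℤ/2 be the quadratic character (χ x = 0ℙ iff x is a square) and, for
-- s, t ∈ ℤ/2, let N s t count the x ∉ {0, 1} with χ(x) = s and χ(1 - x) = t.
-- Enumerating F^* by a generator γ (of order q - 1, which is even) shows χ(γ^i) = parity i,
-- so a dot (i, j), i.e. α^i + β^j = 1, has parities (χ(α^i), χ(1 - α^i)); hence the number
-- of dots of parity class (a, b) is N a b.  The four numbers N s t satisfy
--   N s t = N t s                                   (x ↦ 1 - x),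
--   N 0 0 + N 0 1 = (q - 3)/2,  N 1 0 + N 1 1 = (q - 1)/2   (squares among γ^1, …, γ^(q-2)),
--   N s t = N s (t ⊕ (χ(-1) ⊕ s))                   (x ↦ x⁻¹, χ being multiplicative),
-- with χ(-1) = parity ((q - 1)/2); solving this system in each class of q modulo 4 gives the
-- theorem.

open import Defs

module ListSums where
  open import Data.Nat.Base using (ℕ; zero; suc; _+_)
  open import Data.Nat.Properties using (+-0-commutativeMonoid)
  open import Data.Nat.ListAction using (sum)
  open import Data.Nat.ListAction.Properties using (sum-++)
  open import Data.Bool.Base using (Bool; true; false)
  open import Data.Fin.Base using (toℕ)
  open import Data.List.Base using (List; []; _∷_; _++_; map; filter; length; applyUpTo; upTo; cartesianProduct)
  open import Data.List.Properties using (map-++; map-∘; map-applyUpTo)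
  open import Data.Product.Base using (_×_; _,_)
  open import Function.Base using (_∘_)
  open import Relation.Nullary.Decidable.Core using (does)
  open import Relation.Unary using (Pred; Decidable)
  open import Relation.Binary.PropositionalEquality using (_≡_; refl; sym; cong; cong₂; module ≡-Reasoning)
  open ≡-Reasoning
  open import Algebra.Properties.CommutativeMonoid.Sum +-0-commutativeMonoid using (sum-syntax)

  𝟙 : Bool → ℕ
  𝟙 true  = 1
  𝟙 false = 0

  length-filter : ∀ {a p} {A : Set a} {P : Pred A p} (P? : Decidable P) (xs : List A) →
                  length (filter P? xs) ≡ sum (map (λ x → 𝟙 (does (P? x))) xs)
  length-filter P? []       = refl
  length-filter P? (x ∷ xs) with does (P? x)
  ... | true  = cong suc (length-filter P? xs)
  ... | false = length-filter P? xs

  sum-cartesianProduct : ∀ {a b} {A : Set a} {B : Set b} (h : A × B → ℕ) (xs : List A) (ys : List B) →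
    sum (map h (cartesianProduct xs ys)) ≡ sum (map (λ x → sum (map (λ y → h (x , y)) ys)) xs)
  sum-cartesianProduct h []       ys = refl
  sum-cartesianProduct h (x ∷ xs) ys = begin
    sum (map h (map (x ,_) ys ++ cartesianProduct xs ys))
      ≡⟨ cong sum (map-++ h (map (x ,_) ys) _) ⟩
    sum (map h (map (x ,_) ys) ++ map h (cartesianProduct xs ys))
      ≡⟨ sum-++ (map h (map (x ,_) ys)) _ ⟩
    sum (map h (map (x ,_) ys)) + sum (map h (cartesianProduct xs ys))
      ≡⟨ cong₂ _+_ (cong sum (sym (map-∘ ys))) (sum-cartesianProduct h xs ys) ⟩
    sum (map (λ y → h (x , y)) ys) + sum (map (λ x → sum (map (λ y → h (x , y)) ys)) xs) ∎

  sum-applyUpTo : (f : ℕ → ℕ) (n : ℕ) → sum (applyUpTo f n) ≡ ∑[ i < n ] f (toℕ i)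
  sum-applyUpTo f zero    = refl
  sum-applyUpTo f (suc n) = cong (f 0 +_) (sum-applyUpTo (f ∘ suc) n)

  sum-positive : (f : ℕ → ℕ) (n : ℕ) → sum (map f (map suc (upTo n))) ≡ ∑[ i < n ] f (suc (toℕ i))
  sum-positive f n = begin
    sum (map f (map suc (upTo n)))  ≡⟨ cong sum (sym (map-∘ (upTo n))) ⟩
    sum (map (f ∘ suc) (upTo n))    ≡⟨ cong sum (map-applyUpTo (λ i → i) (f ∘ suc) n) ⟩
    sum (applyUpTo (f ∘ suc) n)     ≡⟨ sum-applyUpTo (f ∘ suc) n ⟩
    ∑[ i < n ] f (suc (toℕ i))      ∎

open ListSums

module ParityFacts where
  open import Data.Nat.Base using (zero; suc; _+_; _*_; _%_; _/_; _≤_; z≤n; s≤s; NonZero; parity; ⌊_/2⌋; ⌈_/2⌉)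
  open import Data.Nat.Properties using (+-suc; +-comm; _≟_; +-0-commutativeMonoid)
  open import Data.Nat.DivMod using (m≡m%n+[m/n]*n; [m+kn]%n≡m%n)
  open import Data.Parity.Base using (Parity; 0ℙ; 1ℙ) renaming (_+_ to _⊕_)
  open import Data.Parity.Properties as ℙ using (+-homo-+; p+p≡0ℙ; +-identityʳ)
  open import Data.Bool.Base using (Bool; true; false; _∧_)
  open import Data.Fin.Base using (toℕ)
  open import Data.Product.Base using (∃; _,_)
  open import Function.Bundles using (_⇔_; mk⇔)
  open import Relation.Nullary.Decidable using (does; does-⇔; yes; no)
  open import Relation.Binary.PropositionalEquality using (_≡_; refl; sym; trans; cong; cong₂; module ≡-Reasoning)
  open import Algebra.Properties.CommutativeMonoid.Sum +-0-commutativeMonoid using (sum-syntax)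
  open ≡-Reasoning

  _≡ᵇ_ : Parity → Parity → Bool
  p ≡ᵇ s = does (p ℙ.≟ s)

  %2-test : ∀ i {a} → a ≤ 1 → does (i % 2 ≟ a) ≡ parity i ≡ᵇ parity a
  %2-test zero          z≤n       = refl
  %2-test zero          (s≤s z≤n) = refl
  %2-test (suc zero)    z≤n       = refl
  %2-test (suc zero)    (s≤s z≤n) = refl
  %2-test (suc (suc i)) {a} a≤1   = trans (cong (λ r → does (r ≟ a)) ss%2) (%2-test i a≤1)
    where
    ss%2 : suc (suc i) % 2 ≡ i % 2
    ss%2 = trans (cong (_% 2) (+-comm 2 i)) ([m+kn]%n≡m%n i 1 2)

  parity-double : ∀ k → parity (k + k) ≡ 0ℙ
  parity-double k = trans (+-homo-+ k k) (p+p≡0ℙ (parity k))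

  parity-odd : ∀ k → parity (suc (k + k)) ≡ 1ℙ
  parity-odd k = trans (+-homo-+ 1 (k + k)) (cong (1ℙ ⊕_) (parity-double k))

  even⇒double : ∀ i → parity i ≡ 0ℙ → ∃ λ k → i ≡ k + k
  even⇒double zero          _ = 0 , refl
  even⇒double (suc (suc i)) e with even⇒double i e
  ... | k , i≡k+k = suc k , cong suc (trans (cong suc i≡k+k) (sym (+-suc k k)))

  parity-multiple : ∀ t m → parity m ≡ 0ℙ → parity (t * m) ≡ 0ℙ
  parity-multiple zero    m even-m = refl
  parity-multiple (suc t) m even-m = begin
    parity (m + t * m)             ≡⟨ +-homo-+ m (t * m) ⟩
    parity m ⊕ parity (t * m)      ≡⟨ cong₂ _⊕_ even-m (parity-multiple t m even-m) ⟩
    0ℙ                             ∎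

  parity-mod : ∀ k m .{{_ : NonZero m}} → parity m ≡ 0ℙ → parity (k % m) ≡ parity k
  parity-mod k m even-m = sym (begin
    parity k                                ≡⟨ cong parity (m≡m%n+[m/n]*n k m) ⟩
    parity (k % m + (k / m) * m)            ≡⟨ +-homo-+ (k % m) _ ⟩
    parity (k % m) ⊕ parity ((k / m) * m)   ≡⟨ cong (parity (k % m) ⊕_) (parity-multiple (k / m) m even-m) ⟩
    parity (k % m) ⊕ 0ℙ                     ≡⟨ +-identityʳ (parity (k % m)) ⟩
    parity (k % m)                          ∎)

  parity-≡-mod : ∀ {a b} m .{{_ : NonZero m}} → parity m ≡ 0ℙ → a % m ≡ b % m → parity a ≡ parity b
  parity-≡-mod {a} {b} m even-m a≡b =
    trans (sym (parity-mod a m even-m)) (trans (cong parity a≡b) (parity-mod b m even-m))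

  parity-ext : ∀ {p s} → (p ≡ 0ℙ → s ≡ 0ℙ) → (s ≡ 0ℙ → p ≡ 0ℙ) → p ≡ s
  parity-ext {0ℙ} {0ℙ} _  _  = refl
  parity-ext {0ℙ} {1ℙ} to _   = sym (to refl)
  parity-ext {1ℙ} {0ℙ} _ from = from refl
  parity-ext {1ℙ} {1ℙ} _  _  = refl

  count-evens : ∀ n → ∑[ k < n ] 𝟙 (parity (suc (toℕ k)) ≡ᵇ 0ℙ) ≡ ⌊ n /2⌋
  count-evens zero          = refl
  count-evens (suc zero)    = refl
  count-evens (suc (suc n)) = cong suc (count-evens n)

  count-odds : ∀ n → ∑[ k < n ] 𝟙 (parity (suc (toℕ k)) ≡ᵇ 1ℙ) ≡ ⌈ n /2⌉
  count-odds zero          = refl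
  count-odds (suc zero)    = refl
  count-odds (suc (suc n)) = cong suc (count-odds n)

  ⌊2u/2⌋≡u : ∀ u → ⌊ u + u /2⌋ ≡ u
  ⌊2u/2⌋≡u zero    = refl
  ⌊2u/2⌋≡u (suc u) = trans (cong (λ m → ⌊ suc m /2⌋) (+-suc u u)) (cong suc (⌊2u/2⌋≡u u))

  ⌊2u+1/2⌋≡u : ∀ u → ⌊ suc (u + u) /2⌋ ≡ u
  ⌊2u+1/2⌋≡u zero    = refl
  ⌊2u+1/2⌋≡u (suc u) = trans (cong (λ m → ⌊ suc (suc m) /2⌋) (+-suc u u)) (cong suc (⌊2u+1/2⌋≡u u))

  ⊕-cancel : ∀ x u → x ⊕ u ⊕ u ≡ x
  ⊕-cancel x u = trans (ℙ.+-assoc x u u) (trans (cong (x ⊕_) (p+p≡0ℙ u)) (+-identityʳ x))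

  ⊕-shift : ∀ b u t → (b ⊕ u ≡ t) ⇔ (b ≡ t ⊕ u)
  ⊕-shift b u t = mk⇔ (λ { refl → sym (⊕-cancel b u) }) (λ { refl → ⊕-cancel t u })

  ⊕≡0⇒≡ : ∀ p s → p ⊕ s ≡ 0ℙ → s ≡ p
  ⊕≡0⇒≡ p s p⊕s≡0 = ℙ.+-cancelˡ-≡ p s p (trans p⊕s≡0 (sym (p+p≡0ℙ p)))

  shifted-condition : ∀ p s b u t → (p ≡ᵇ s ∧ (b ⊕ (u ⊕ p)) ≡ᵇ t) ≡ (p ≡ᵇ s ∧ b ≡ᵇ (t ⊕ (u ⊕ s)))
  shifted-condition p s b u t with p ℙ.≟ s
  ... | yes refl = does-⇔ (⊕-shift b (u ⊕ p) t) (b ⊕ (u ⊕ p) ℙ.≟ t) (b ℙ.≟ t ⊕ (u ⊕ p))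
  ... | no _     = refl

  split-by-parity : ∀ a b p → 𝟙 (a ∧ b) ≡ 𝟙 (a ∧ (b ∧ p ≡ᵇ 0ℙ)) + 𝟙 (a ∧ (b ∧ p ≡ᵇ 1ℙ))
  split-by-parity false b     p  = refl
  split-by-parity true  false p  = refl
  split-by-parity true  true  0ℙ = refl
  split-by-parity true  true  1ℙ = refl

  ∧-guard : ∀ {a P Q} → (a ≡ true → P ≡ Q) → a ∧ P ≡ a ∧ Q
  ∧-guard {true}  P≡Q = P≡Q refl
  ∧-guard {false} _   = refl

open ParityFacts

module LeastWitness where
  open import Data.Nat.Base using (ℕ; zero; suc; _<_)
  open import Data.Nat.Properties using (n<1+n; m<n⇒m<1+n; m<1+n⇒m<n∨m≡n)
  open import Data.Product.Base using (∃; _×_; _,_)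
  open import Data.Sum.Base using (_⊎_; inj₁; inj₂; [_,_])
  open import Data.Empty using (⊥-elim)
  open import Relation.Nullary using (¬_; yes; no)
  open import Relation.Unary using (Pred; Decidable)
  open import Relation.Binary.PropositionalEquality using (refl)

  module _ {p} {P : Pred ℕ p} (P? : Decidable P) where

    NoneBelow : ℕ → Set p
    NoneBelow m = ∀ {n} → n < m → ¬ P n

    firstBelow : ∀ d → (∃ λ m → m < d × P m × NoneBelow m) ⊎ NoneBelow d
    firstBelow zero = inj₂ λ ()
    firstBelow (suc d) with firstBelow d
    ... | inj₁ (m , m<d , pm , below) = inj₁ (m , m<n⇒m<1+n m<d , pm , below)
    ... | inj₂ none with P? d
    ...   | yes pd = inj₁ (d , n<1+n d , pd , none)
    ...   | no ¬pd = inj₂ λ n<1+d → [ none , (λ { refl → ¬pd }) ] (m<1+n⇒m<n∨m≡n n<1+d)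

    least : ∀ {d} → P d → ∃ λ m → P m × NoneBelow m
    least {d} pd with firstBelow (suc d)
    ... | inj₁ (m , _ , pm , below) = m , pm , below
    ... | inj₂ none                 = ⊥-elim (none (n<1+n d) pd)

open LeastWitness

module FieldFacts {q} (F : FiniteField q) where
  open FiniteField F
  open import Data.Nat.Base as ℕ using (ℕ; zero; suc; parity)
  open import Data.Nat.Properties
    using (+-0-commutativeMonoid; _≤?_; m+[n∸m]≡n; n<1+n; m<n⇒0<n∸m; <⇒≤; <-cmp; m<m+n; ≤-<-trans; m∸n≤m)
  open import Data.Nat.DivMod using (m≡m%n+[m/n]*n; m%n<n)
  open import Data.Parity.Base using (Parity; 0ℙ; 1ℙ) renaming (_+_ to _⊕_)
  import Data.Parity.Properties as ℙ
  open import Data.Bool.Base using (Bool; true; false; _∧_; if_then_else_)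
  open import Data.Bool.Properties using (∧-zeroʳ)
  open import Data.Fin.Base as Fin using (Fin)
  open import Data.Fin.Properties using (any?; pigeonhole; toℕ-fromℕ<; toℕ-injective; toℕ<n) renaming (_≟_ to _≟Fin_)
  open import Data.Fin.Permutation using (Permutation; permutation; ↔⇒≡)
  open import Data.Product.Base using (∃; _×_; _,_; proj₁; proj₂)
  open import Data.Empty using (⊥-elim)
  open import Function.Base using (_∘_)
  open import Function.Bundles using (_⇔_; mk⇔)
  open import Relation.Unary using (Decidable)
  open import Relation.Nullary using (¬_; Dec; does; yes; no)
  import Relation.Nullary.Decidable as Dec
  open import Relation.Nullary.Decidable using (does-⇔; dec-true; dec-false; decidable-stable; _×-dec_)
  open import Relation.Binary.Definitions using (tri<; tri≈; tri>)
  open import Relation.Binary.PropositionalEquality as ≡ using (_≡_)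
  open import Relation.Binary.Reasoning.Setoid setoid
  open import Algebra.Properties.Ring ring
    using (-1*x≈-x; x[y-z]≈xy-xz; -0#≈0#; -‿injective; -‿distribˡ-*; ⁻¹-anti-homo‿-;
           x∙y⁻¹≈ε⇒x≈y; x≈y⇒x∙y⁻¹≈ε; xyx⁻¹≈y)
  open import Algebra.Properties.CommutativeMonoid.Sum +-0-commutativeMonoid
    using (sum-syntax; sum-cong-≗; sum-permute; ∑-distrib-+; sum-replicate-zero)

  nonzero-cancel : ∀ {x a b} → ¬ x ≈ 0# → x * a ≈ x * b → a ≈ b
  nonzero-cancel {x} {a} {b} x≉0 xa≈xb with inverse x x≉0
  ... | w , xw≈1 = x∙y⁻¹≈ε⇒x≈y a b (begin
    a - b              ≈⟨ *-identityˡ (a - b) ⟨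
    1# * (a - b)       ≈⟨ *-congʳ (trans (sym xw≈1) (*-comm x w)) ⟩
    (w * x) * (a - b)  ≈⟨ *-assoc w x (a - b) ⟩
    w * (x * (a - b))  ≈⟨ *-congˡ (trans (x[y-z]≈xy-xz x a b) (x≈y⇒x∙y⁻¹≈ε xa≈xb)) ⟩
    w * 0#             ≈⟨ zeroʳ w ⟩
    0#                 ∎)

  nonzero-* : ∀ {x y} → ¬ x ≈ 0# → ¬ y ≈ 0# → ¬ x * y ≈ 0#
  nonzero-* {x} {y} x≉0 y≉0 xy≈0 = y≉0 (nonzero-cancel x≉0 (trans xy≈0 (sym (zeroʳ x))))

  1≉0 : ¬ 1# ≈ 0#
  1≉0 1≈0 = 0≉1 (sym 1≈0)

  -1≉0 : ¬ - 1# ≈ 0#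
  -1≉0 -1≈0 = 1≉0 (-‿injective (trans -1≈0 (sym -0#≈0#)))

  1-[1-x]≈x : ∀ x → 1# - (1# - x) ≈ x
  1-[1-x]≈x x = begin
    1# + - (1# - x)   ≈⟨ +-congˡ (⁻¹-anti-homo‿- 1# x) ⟩
    1# + (x - 1#)     ≈⟨ +-congˡ (+-comm x (- 1#)) ⟩
    1# + (- 1# + x)   ≈⟨ +-assoc 1# (- 1#) x ⟨
    (1# - 1#) + x     ≈⟨ +-congʳ (-‿inverseʳ 1#) ⟩
    0# + x            ≈⟨ +-identityˡ x ⟩
    x                 ∎

  1-x≈0⇔x≈1 : ∀ x → (1# - x ≈ 0#) ⇔ (x ≈ 1#)
  1-x≈0⇔x≈1 x = mk⇔ (λ e → sym (x∙y⁻¹≈ε⇒x≈y 1# x e)) (λ e → x≈y⇒x∙y⁻¹≈ε (sym e))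

  1-x≈1⇔x≈0 : ∀ x → (1# - x ≈ 1#) ⇔ (x ≈ 0#)
  1-x≈1⇔x≈0 x = mk⇔ to from
    where
    to : 1# - x ≈ 1# → x ≈ 0#
    to e = -‿injective (trans (x∙y⁻¹≈ε⇒x≈y (- x) 0# (begin
      - x - 0#          ≈⟨ +-congˡ -0#≈0# ⟩
      - x + 0#          ≈⟨ +-identityʳ (- x) ⟩
      - x               ≈⟨ xyx⁻¹≈y 1# (- x) ⟨
      1# - x - 1#       ≈⟨ +-congʳ e ⟩
      1# - 1#           ≈⟨ -‿inverseʳ 1# ⟩
      0#                ∎)) (sym -0#≈0#))
    from : x ≈ 0# → 1# - x ≈ 1#
    from e = trans (+-congˡ (trans (-‿cong e) -0#≈0#)) (+-identityʳ 1#)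

  +≈1⇔≈1- : ∀ a y → (a + y ≈ 1#) ⇔ (y ≈ 1# - a)
  +≈1⇔≈1- a y = mk⇔ (λ e → trans (sym (xyx⁻¹≈y a y)) (+-congʳ e)) from
    where
    from : y ≈ 1# - a → a + y ≈ 1#
    from e = begin
      a + y           ≈⟨ +-congˡ e ⟩
      a + (1# - a)    ≈⟨ +-assoc a 1# (- a) ⟨
      a + 1# - a      ≈⟨ xyx⁻¹≈y a 1# ⟩
      1#              ∎

  sqrt-one : ∀ z → z * z ≈ 1# → ¬ z ≈ 1# → z ≈ - 1#
  sqrt-one z zz≈1 z≉1 = begin
    z               ≈⟨ xyx⁻¹≈y 1# z ⟨
    1# + z - 1#     ≈⟨ +-congʳ (trans (+-comm 1# z) z+1≈0) ⟩
    0# - 1#         ≈⟨ +-identityˡ (- 1#) ⟩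
    - 1#            ∎
    where
    z-1≉0 : ¬ z - 1# ≈ 0#
    z-1≉0 e = z≉1 (x∙y⁻¹≈ε⇒x≈y z 1# e)
    product≈0 : (z - 1#) * (z + 1#) ≈ 0#
    product≈0 = begin
      (z - 1#) * (z + 1#)             ≈⟨ *-comm (z - 1#) (z + 1#) ⟩
      (z + 1#) * (z - 1#)             ≈⟨ distribʳ (z - 1#) z 1# ⟩
      z * (z - 1#) + 1# * (z - 1#)    ≈⟨ +-cong (x[y-z]≈xy-xz z z 1#) (*-identityˡ (z - 1#)) ⟩
      (z * z - z * 1#) + (z - 1#)     ≈⟨ +-congʳ (+-cong zz≈1 (-‿cong (*-identityʳ z))) ⟩
      (1# - z) + (z - 1#)             ≈⟨ +-assoc 1# (- z) (z - 1#) ⟩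
      1# + (- z + (z - 1#))           ≈⟨ +-congˡ (+-assoc (- z) z (- 1#)) ⟨
      1# + ((- z + z) - 1#)           ≈⟨ +-congˡ (+-congʳ (-‿inverseˡ z)) ⟩
      1# + (0# - 1#)                  ≈⟨ +-congˡ (+-identityˡ (- 1#)) ⟩
      1# - 1#                         ≈⟨ -‿inverseʳ 1# ⟩
      0#                              ∎
    z+1≈0 : z + 1# ≈ 0#
    z+1≈0 = nonzero-cancel z-1≉0 (trans product≈0 (sym (zeroʳ (z - 1#))))

  -- The inverse map, extended by 0 ↦ 0 to a total involution of F.
  inv : Carrier → Carrier
  inv x with x ≟ 0#
  ... | yes _   = 0#
  ... | no x≉0 = proj₁ (inverse x x≉0)

  inv-inverse : ∀ {x} → ¬ x ≈ 0# → x * inv x ≈ 1#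
  inv-inverse {x} x≉0 with x ≟ 0#
  ... | yes x≈0 = ⊥-elim (x≉0 x≈0)
  ... | no x≉0′ = proj₂ (inverse x x≉0′)

  inv-zero : ∀ {x} → x ≈ 0# → inv x ≈ 0#
  inv-zero {x} x≈0 with x ≟ 0#
  ... | yes _   = refl
  ... | no x≉0 = ⊥-elim (x≉0 x≈0)

  factor-nonzero : ∀ {x y} → x * y ≈ 1# → ¬ y ≈ 0#
  factor-nonzero {x} xy≈1 y≈0 = 0≉1 (trans (sym (trans (*-congˡ y≈0) (zeroʳ x))) xy≈1)

  inverse-unique : ∀ {x y z} → x * y ≈ 1# → x * z ≈ 1# → y ≈ z
  inverse-unique {x} {y} xy≈1 xz≈1 =
    nonzero-cancel (factor-nonzero (trans (*-comm y x) xy≈1)) (trans xy≈1 (sym xz≈1))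

  inv-nonzero : ∀ {x} → ¬ x ≈ 0# → ¬ inv x ≈ 0#
  inv-nonzero x≉0 = factor-nonzero (inv-inverse x≉0)

  inv-cong : ∀ {x y} → x ≈ y → inv x ≈ inv y
  inv-cong {x} {y} x≈y with x ≟ 0#
  ... | yes x≈0 = sym (inv-zero (trans (sym x≈y) x≈0))
  ... | no x≉0 = inverse-unique (proj₂ (inverse x x≉0))
                   (trans (*-congʳ x≈y) (inv-inverse (λ y≈0 → x≉0 (trans x≈y y≈0))))

  inv-involutive : ∀ x → inv (inv x) ≈ x
  inv-involutive x with x ≟ 0#
  ... | yes x≈0 = trans (inv-zero refl) (sym x≈0)
  ... | no x≉0 with (w , xw≈1) ← inverse x x≉0 =
    inverse-unique (inv-inverse (factor-nonzero xw≈1)) (trans (*-comm w x) xw≈1)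

  inv-one : inv 1# ≈ 1#
  inv-one = inverse-unique (inv-inverse 1≉0) (*-identityˡ 1#)

  involution-fixed : (g : Carrier → Carrier) → (∀ {x y} → x ≈ y → g x ≈ g y) → (∀ x → g (g x) ≈ x) →
                     ∀ {a} → g a ≈ a → ∀ x → (g x ≈ a) ⇔ (x ≈ a)
  involution-fixed g g-cong g-involutive {a} ga≈a x =
    mk⇔ (λ gx≈a → trans (sym (g-involutive x)) (trans (g-cong gx≈a) ga≈a))
        (λ x≈a → trans (g-cong x≈a) ga≈a)

  1-inv : ∀ {x} → ¬ x ≈ 0# → 1# - inv x ≈ - 1# * ((1# - x) * inv x)
  1-inv {x} x≉0 = sym (begin
    - 1# * ((1# - x) * w)       ≈⟨ -1*x≈-x _ ⟩
    - ((1# - x) * w)            ≈⟨ -‿cong (distribʳ w 1# (- x)) ⟩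
    - (1# * w + - x * w)        ≈⟨ -‿cong (+-cong (*-identityˡ w) (sym (-‿distribˡ-* x w))) ⟩
    - (w - x * w)               ≈⟨ -‿cong (+-congˡ (-‿cong (inv-inverse x≉0))) ⟩
    - (w - 1#)                  ≈⟨ ⁻¹-anti-homo‿- w 1# ⟩
    1# - w                      ∎)
    where w = inv x

  _≈ᵇ_ : Carrier → Carrier → Bool
  x ≈ᵇ y = does (x ≟ y)

  Respects : (Carrier → Bool) → Set
  Respects f = ∀ {x y} → x ≈ y → f x ≡ f y

  ≈ᵇ-respects : ∀ c → Respects (_≈ᵇ c)
  ≈ᵇ-respects c x≈y = does-⇔ (mk⇔ (trans (sym x≈y)) (trans x≈y)) (_ ≟ c) (_ ≟ c)

  count : (Carrier → Bool) → ℕ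
  count f = ∑[ i < q ] 𝟙 (f (fromFin i))

  count-cong : ∀ {f g} → (∀ x → f x ≡ g x) → count f ≡ count g
  count-cong f≗g = sum-cong-≗ (λ i → ≡.cong 𝟙 (f≗g (fromFin i)))

  count-involution : (g : Carrier → Carrier) → (∀ {x y} → x ≈ y → g x ≈ g y) → (∀ x → g (g x) ≈ x) →
                     ∀ {f} → Respects f → count f ≡ count (f ∘ g)
  count-involution g g-cong g-involutive {f} f-resp =
    ≡.trans (sum-permute _ π) (sum-cong-≗ (λ i → ≡.cong 𝟙 (f-resp (from∘to (g (fromFin i))))))
    where
    h : Fin q → Fin q
    h i = toFin (g (fromFin i))
    h-involutive : ∀ i → h (h i) ≡ i
    h-involutive i = ≡.trans (toFin-cong (trans (g-cong (from∘to _)) (g-involutive _))) (to∘from i)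
    π : Permutation q q
    π = permutation h h h-involutive h-involutive

  count-split : ∀ f g h → (∀ x → 𝟙 (f x) ≡ 𝟙 (g x) ℕ.+ 𝟙 (h x)) → count f ≡ count g ℕ.+ count h
  count-split f g h split = ≡.trans (sum-cong-≗ (λ i → split (fromFin i)))
                                    (∑-distrib-+ (λ i → 𝟙 (g (fromFin i))) (λ i → 𝟙 (h (fromFin i))))

  count-single : ∀ d → count (_≈ᵇ d) ≡ 1
  count-single d =
    ≡.trans (sum-cong-≗ (λ i → ≡.cong 𝟙 (does-⇔ (mk⇔ to from) (fromFin i ≟ d) (i ≟Fin toFin d))))
            (one-hot (toFin d))
    where
    to : ∀ {i} → fromFin i ≈ d → i ≡ toFin d
    to {i} e = ≡.trans (≡.sym (to∘from i)) (toFin-cong e)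
    from : ∀ {i} → i ≡ toFin d → fromFin i ≈ d
    from ≡.refl = from∘to d
    one-hot : ∀ {n} (k : Fin n) → ∑[ i < n ] 𝟙 (does (i ≟Fin k)) ≡ 1
    one-hot {suc n} Fin.zero    = ≡.cong suc (sum-replicate-zero n)
    one-hot {suc n} (Fin.suc k) = one-hot k

  count-point : ∀ {B} → Respects B → ∀ d → count (λ y → B y ∧ y ≈ᵇ d) ≡ 𝟙 (B d)
  count-point {B} B-resp d = ≡.trans (count-cong at-d) (by-value (B d))
    where
    at-d : ∀ y → (B y ∧ y ≈ᵇ d) ≡ (B d ∧ y ≈ᵇ d)
    at-d y with y ≟ d
    ... | yes y≈d = ≡.cong (_∧ true) (B-resp y≈d)
    ... | no _    = ≡.trans (∧-zeroʳ (B y)) (≡.sym (∧-zeroʳ (B d)))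
    by-value : ∀ b → count (λ y → b ∧ y ≈ᵇ d) ≡ 𝟙 b
    by-value true  = count-single d
    by-value false = sum-replicate-zero q

  root-nonzero : ∀ {x y} → y * y ≈ x → ¬ x ≈ 0# → ¬ y ≈ 0#
  root-nonzero {x} {y} yy≈x x≉0 y≈0 = x≉0 (trans (sym yy≈x) (trans (*-congʳ y≈0) (zeroˡ y)))

  IsSquare : Carrier → Set
  IsSquare x = ∃ λ y → y * y ≈ x

  isSquare? : ∀ x → Dec (IsSquare x)
  isSquare? x = Dec.map (mk⇔ (λ (i , e) → fromFin i , e)
                             (λ (y , e) → toFin y , trans (*-cong (from∘to y) (from∘to y)) e))
                        (any? (λ i → (fromFin i * fromFin i) ≟ x))

  χ : Carrier → Parity
  χ x = if does (isSquare? x) then 0ℙ else 1ℙ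

  χ-respects : ∀ {x y} → x ≈ y → χ x ≡ χ y
  χ-respects {x} {y} x≈y = ≡.cong (if_then 0ℙ else 1ℙ)
    (does-⇔ (mk⇔ (λ (z , e) → z , trans e x≈y) (λ (z , e) → z , trans e (sym x≈y)))
            (isSquare? x) (isSquare? y))

  χ-square : ∀ {x} → IsSquare x → χ x ≡ 0ℙ
  χ-square {x} sq = ≡.cong (if_then 0ℙ else 1ℙ) (dec-true (isSquare? x) sq)

  χ-one : χ 1# ≡ 0ℙ
  χ-one = χ-square (1# , *-identityˡ 1#)

  χ≡0⇒square : ∀ {x} → χ x ≡ 0ℙ → IsSquare x
  χ≡0⇒square {x} χx≡0 =
    decidable-stable (isSquare? x) (λ ¬sq → 1≢0 (≡.trans (≡.sym (nonsquare ¬sq)) χx≡0))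
    where
    nonsquare : ¬ IsSquare x → χ x ≡ 1ℙ
    nonsquare ¬sq = ≡.cong (if_then 0ℙ else 1ℙ) (dec-false (isSquare? x) ¬sq)
    1≢0 : ¬ 1ℙ ≡ 0ℙ
    1≢0 ()

  infixr 8 _^_
  _^_ : Carrier → ℕ → Carrier
  x ^ n = pow F x n

  ^-+ : ∀ x a b → x ^ (a ℕ.+ b) ≈ x ^ a * x ^ b
  ^-+ x zero    b = sym (*-identityˡ _)
  ^-+ x (suc a) b = trans (*-congˡ (^-+ x a b)) (sym (*-assoc _ _ _))

  ^-nonzero : ∀ {x} n → ¬ x ≈ 0# → ¬ x ^ n ≈ 0#
  ^-nonzero zero    x≉0 = 1≉0
  ^-nonzero (suc n) x≉0 = nonzero-* x≉0 (^-nonzero n x≉0)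

  ^-multiple : ∀ x m t → x ^ m ≈ 1# → x ^ (t ℕ.* m) ≈ 1#
  ^-multiple x m zero    xᵐ≈1 = refl
  ^-multiple x m (suc t) xᵐ≈1 =
    trans (^-+ x m (t ℕ.* m)) (trans (*-cong xᵐ≈1 (^-multiple x m t xᵐ≈1)) (*-identityˡ 1#))

  ^-difference : ∀ {x a b} → ¬ x ≈ 0# → a ℕ.≤ b → x ^ a ≈ x ^ b → x ^ (b ℕ.∸ a) ≈ 1#
  ^-difference {x} {a} {b} x≉0 a≤b xᵃ≈xᵇ = sym (nonzero-cancel (^-nonzero a x≉0) (begin
    x ^ a * 1#              ≈⟨ *-identityʳ _ ⟩
    x ^ a                   ≈⟨ xᵃ≈xᵇ ⟩
    x ^ b                   ≡⟨ ≡.cong (x ^_) (≡.sym (m+[n∸m]≡n a≤b)) ⟩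
    x ^ (a ℕ.+ (b ℕ.∸ a))   ≈⟨ ^-+ x a (b ℕ.∸ a) ⟩
    x ^ a * x ^ (b ℕ.∸ a)   ∎))

  toFin-injective : ∀ {x y} → toFin x ≡ toFin y → x ≈ y
  toFin-injective {x} {y} e = trans (sym (from∘to x)) (trans (reflexive (≡.cong fromFin e)) (from∘to y))

  module Generator (γ : Carrier) (gen : IsGenerator F γ) where

    γ≉0 : ¬ γ ≈ 0#
    γ≉0 = proj₁ gen

    IsPeriod : ℕ → Set
    IsPeriod n = 1 ℕ.≤ n × γ ^ n ≈ 1#

    isPeriod? : Decidable IsPeriod
    isPeriod? n = (1 ≤? n) ×-dec ((γ ^ n) ≟ 1#)

    -- Some positive power of γ is 1: by pigeonhole two of γ^0, …, γ^q coincide.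
    period : ∃ IsPeriod
    period with pigeonhole (n<1+n q) (λ (i : Fin (suc q)) → toFin (γ ^ Fin.toℕ i))
    ... | i , j , i<j , same = _ , m<n⇒0<n∸m i<j , ^-difference γ≉0 (<⇒≤ i<j) (toFin-injective same)

    -- The order m of γ: the least period.
    -- (Opaque: only the properties of the least period are used, never its computation.)
    opaque
      order : ∃ λ m → IsPeriod m × NoneBelow isPeriod? m
      order = least isPeriod? (proj₂ period)

    m : ℕ
    m = proj₁ order

    1≤m : 1 ℕ.≤ m
    1≤m = proj₁ (proj₁ (proj₂ order))

    γᵐ≈1 : γ ^ m ≈ 1#
    γᵐ≈1 = proj₂ (proj₁ (proj₂ order))

    instance
      m-nonZero : ℕ.NonZero m
      m-nonZero = ℕ.>-nonZero 1≤m

    order-minimal : ∀ {k} → 1 ℕ.≤ k → k ℕ.< m → ¬ γ ^ k ≈ 1#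
    order-minimal 1≤k k<m γᵏ≈1 = proj₂ (proj₂ order) k<m (1≤k , γᵏ≈1)

    ^-injective : ∀ {a b} → a ℕ.< m → b ℕ.< m → γ ^ a ≈ γ ^ b → a ≡ b
    ^-injective {a} {b} a<m b<m γᵃ≈γᵇ with <-cmp a b
    ... | tri≈ _ a≡b _ = a≡b
    ... | tri< a<b _ _ = ⊥-elim (order-minimal (m<n⇒0<n∸m a<b) (≤-<-trans (m∸n≤m b a) b<m)
                                               (^-difference γ≉0 (<⇒≤ a<b) γᵃ≈γᵇ))
    ... | tri> _ _ b<a = ⊥-elim (order-minimal (m<n⇒0<n∸m b<a) (≤-<-trans (m∸n≤m a b) a<m)
                                               (^-difference γ≉0 (<⇒≤ b<a) (sym γᵃ≈γᵇ)))

    ^-mod : ∀ k → γ ^ k ≈ γ ^ (k ℕ.% m)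
    ^-mod k = begin
      γ ^ k                                    ≡⟨ ≡.cong (γ ^_) (m≡m%n+[m/n]*n k m) ⟩
      γ ^ (k ℕ.% m ℕ.+ (k ℕ./ m) ℕ.* m)        ≈⟨ ^-+ γ (k ℕ.% m) _ ⟩
      γ ^ (k ℕ.% m) * γ ^ ((k ℕ./ m) ℕ.* m)    ≈⟨ *-congˡ (^-multiple γ m (k ℕ./ m) γᵐ≈1) ⟩
      γ ^ (k ℕ.% m) * 1#                       ≈⟨ *-identityʳ _ ⟩
      γ ^ (k ℕ.% m)                            ∎

    opaque
      log : ∀ x → ¬ x ≈ 0# → ∃ λ i → i ℕ.< m × γ ^ i ≈ x
      log x x≉0 with proj₂ gen x x≉0
      ... | k , γᵏ≈x = k ℕ.% m , m%n<n k m , trans (sym (^-mod k)) γᵏ≈x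

    enumerate : Fin (suc m) → Fin q
    enumerate Fin.zero    = toFin 0#
    enumerate (Fin.suc i) = toFin (γ ^ Fin.toℕ i)

    index : Fin q → Fin (suc m)
    index j with fromFin j ≟ 0#
    ... | yes _   = Fin.zero
    ... | no j≉0 = Fin.suc (Fin.fromℕ< (proj₁ (proj₂ (log (fromFin j) j≉0))))

    enumerate-index : ∀ j → enumerate (index j) ≡ j
    enumerate-index j with fromFin j ≟ 0#
    ... | yes j≈0 = ≡.trans (toFin-cong (sym j≈0)) (to∘from j)
    ... | no j≉0 with (i , i<m , γⁱ≈j) ← log (fromFin j) j≉0 =
      ≡.trans (toFin-cong (trans (reflexive (≡.cong (γ ^_) (toℕ-fromℕ< i<m))) γⁱ≈j)) (to∘from j)

    index-enumerate : ∀ i → index (enumerate i) ≡ i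
    index-enumerate Fin.zero with fromFin (toFin 0#) ≟ 0#
    ... | yes _   = ≡.refl
    ... | no 0≉0 = ⊥-elim (0≉0 (from∘to 0#))
    index-enumerate (Fin.suc i) with fromFin (toFin (γ ^ Fin.toℕ i)) ≟ 0#
    ... | yes γⁱ≈0 = ⊥-elim (^-nonzero (Fin.toℕ i) γ≉0 (trans (sym (from∘to _)) γⁱ≈0))
    ... | no γⁱ≉0 with (k , k<m , γᵏ≈γⁱ) ← log (fromFin (toFin (γ ^ Fin.toℕ i))) γⁱ≉0 =
      ≡.cong Fin.suc (toℕ-injective (≡.trans (toℕ-fromℕ< k<m)
        (^-injective k<m (toℕ<n i) (trans γᵏ≈γⁱ (from∘to _)))))

    enumeration : Permutation (suc m) q
    enumeration = permutation enumerate index enumerate-index index-enumerate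

    1+order≡q : suc m ≡ q
    1+order≡q = ↔⇒≡ enumeration

    2≤q : 2 ℕ.≤ q
    2≤q = ≡.subst (2 ℕ.≤_) 1+order≡q (ℕ.s≤s 1≤m)

    count-exponents : ∀ {f} → Respects f → count f ≡ 𝟙 (f 0#) ℕ.+ ∑[ i < m ] 𝟙 (f (γ ^ Fin.toℕ i))
    count-exponents {f} f-resp = ≡.trans (sum-permute _ enumeration)
      (≡.cong₂ ℕ._+_ (≡.cong 𝟙 (f-resp (from∘to 0#)))
                     (sum-cong-≗ {m} (λ i → ≡.cong 𝟙 (f-resp (from∘to (γ ^ Fin.toℕ i))))))

    square-power⇒even : parity m ≡ 0ℙ → ∀ i → IsSquare (γ ^ i) → parity i ≡ 0ℙ
    square-power⇒even even-m i (y , yy≈γⁱ)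
      with (k , _ , γᵏ≈y) ← log y (root-nonzero yy≈γⁱ (^-nonzero i γ≉0)) =
      ≡.trans (parity-≡-mod m even-m (≡.sym same-residue)) (parity-double k)
      where
      same-residue : (k ℕ.+ k) ℕ.% m ≡ i ℕ.% m
      same-residue = ^-injective (m%n<n (k ℕ.+ k) m) (m%n<n i m) (begin
        γ ^ ((k ℕ.+ k) ℕ.% m)  ≈⟨ ^-mod (k ℕ.+ k) ⟨
        γ ^ (k ℕ.+ k)          ≈⟨ ^-+ γ k k ⟩
        γ ^ k * γ ^ k          ≈⟨ *-cong γᵏ≈y γᵏ≈y ⟩
        y * y                  ≈⟨ yy≈γⁱ ⟩
        γ ^ i                  ≈⟨ ^-mod i ⟩
        γ ^ (i ℕ.% m)          ∎)

    χ-power : parity m ≡ 0ℙ → ∀ i → χ (γ ^ i) ≡ parity i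
    χ-power even-m i = parity-ext (square-power⇒even even-m i ∘ χ≡0⇒square) even⇒square
      where
      even⇒square : parity i ≡ 0ℙ → χ (γ ^ i) ≡ 0ℙ
      even⇒square even-i with (k , i≡k+k) ← even⇒double i even-i =
        χ-square (γ ^ k , sym (trans (reflexive (≡.cong (γ ^_) i≡k+k)) (^-+ γ k k)))

    ^-half : ∀ k → m ≡ suc k ℕ.+ suc k → γ ^ suc k ≈ - 1#
    ^-half k m≡2k = sqrt-one (γ ^ suc k) γᵏγᵏ≈1 (order-minimal (ℕ.s≤s ℕ.z≤n) k<m)
      where
      γᵏγᵏ≈1 : γ ^ suc k * γ ^ suc k ≈ 1#
      γᵏγᵏ≈1 = begin
        γ ^ suc k * γ ^ suc k   ≈⟨ ^-+ γ (suc k) (suc k) ⟨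
        γ ^ (suc k ℕ.+ suc k)   ≡⟨ ≡.cong (γ ^_) (≡.sym m≡2k) ⟩
        γ ^ m                   ≈⟨ γᵐ≈1 ⟩
        1#                      ∎
      k<m : suc k ℕ.< m
      k<m = ≡.subst (suc k ℕ.<_) (≡.sym m≡2k) (m<m+n (suc k) (ℕ.s≤s ℕ.z≤n))

    count-nontrivial : ∀ {n f} → m ≡ suc n → Respects f → f 0# ≡ false → f 1# ≡ false →
                       count f ≡ ∑[ k < n ] 𝟙 (f (γ ^ suc (Fin.toℕ k)))
    count-nontrivial {n} {f} m≡1+n f-resp f0 f1 =
      ≡.trans (count-exponents f-resp)
        (≡.cong₂ (λ b s → 𝟙 b ℕ.+ s) f0
          (≡.trans (≡.cong (λ k → ∑[ i < k ] 𝟙 (f (γ ^ Fin.toℕ i))) m≡1+n)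
            (≡.cong (λ b → 𝟙 b ℕ.+ ∑[ k < n ] 𝟙 (f (γ ^ suc (Fin.toℕ k)))) f1)))

    χ-* : parity m ≡ 0ℙ → ∀ {u v} → ¬ u ≈ 0# → ¬ v ≈ 0# → χ (u * v) ≡ χ u ⊕ χ v
    χ-* even-m {u} {v} u≉0 v≉0 with (a , _ , γᵃ≈u) ← log u u≉0 | (b , _ , γᵇ≈v) ← log v v≉0 =
      ≡.trans (χ-respects (sym (trans (^-+ γ a b) (*-cong γᵃ≈u γᵇ≈v))))
        (≡.trans (χ-power even-m (a ℕ.+ b))
          (≡.trans (ℙ.+-homo-+ a b)
            (≡.sym (≡.cong₂ _⊕_ (≡.trans (χ-respects (sym γᵃ≈u)) (χ-power even-m a))
                                (≡.trans (χ-respects (sym γᵇ≈v)) (χ-power even-m b))))))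

module QuadraticClasses {q} (F : FiniteField q) where
  open FiniteField F hiding (refl; sym; trans)
  module FF = FiniteField F
  open FieldFacts F
  open import Data.Nat.Base as ℕ using (ℕ; suc; parity; s≤s; z≤n; _%_; _∸_)
  open import Data.Nat.Properties using (suc-injective; +-suc; +-0-commutativeMonoid) renaming (_≟_ to _≟ℕ_)
  open import Data.Nat.ListAction using (sum)
  open import Data.Parity.Base using (Parity; 0ℙ; 1ℙ) renaming (_+_ to _⊕_)
  import Data.Parity.Properties as ℙ
  open import Data.Bool.Base using (Bool; true; false; not; _∧_)
  open import Data.Bool.Properties using (∧-comm; ∧-zeroʳ; ∧-assoc)
  open import Data.Fin.Base using (Fin; toℕ)
  open import Data.Fin.Properties using (toℕ<n)
  open import Data.List.Base using (List; map; cartesianProduct)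
  open import Data.Product.Base using (_×_; _,_; proj₁; proj₂)
  open import Function.Base using (_∘_)
  open import Function.Bundles using (Equivalence)
  open import Relation.Nullary using (¬_; yes; no; does)
  open import Relation.Nullary.Decidable using (does-⇔; dec-false; dec-true)
  open import Relation.Binary.PropositionalEquality using (_≡_; refl; sym; trans; cong; cong₂; subst; module ≡-Reasoning)
  open import Algebra.Properties.CommutativeSemigroup ℙ.+-commutativeSemigroup using (x∙yz≈y∙xz)
  open import Algebra.Properties.CommutativeMonoid.Sum +-0-commutativeMonoid using (sum-syntax; sum-cong-≗)
  open ≡-Reasoning

  nontrivial : Carrier → Bool
  nontrivial x = not (x ≈ᵇ 0#) ∧ not (x ≈ᵇ 1#)

  -- (Stated on the unfolded definition, so that `with` can inspect the two tests.)
  nontrivial⇒ : ∀ {x} → not (x ≈ᵇ 0#) ∧ not (x ≈ᵇ 1#) ≡ true → ¬ x ≈ 0# × ¬ x ≈ 1#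
  nontrivial⇒ {x} e with x ≟ 0# | x ≟ 1#
  nontrivial⇒ {x} () | yes _   | _
  nontrivial⇒ {x} () | no _    | yes _
  nontrivial⇒ {x} _  | no x≉0 | no x≉1 = x≉0 , x≉1

  nontrivial-intro : ∀ {x} → ¬ x ≈ 0# → ¬ x ≈ 1# → nontrivial x ≡ true
  nontrivial-intro {x} x≉0 x≉1 =
    cong₂ (λ a b → not a ∧ not b) (dec-false (x ≟ 0#) x≉0) (dec-false (x ≟ 1#) x≉1)

  nontrivial-0 : nontrivial 0# ≡ false
  nontrivial-0 = cong (λ b → not b ∧ not (0# ≈ᵇ 1#)) (dec-true (0# ≟ 0#) FF.refl)

  nontrivial-1 : nontrivial 1# ≡ false
  nontrivial-1 = trans (cong (λ b → not (1# ≈ᵇ 0#) ∧ not b) (dec-true (1# ≟ 1#) FF.refl)) (∧-zeroʳ _)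

  count-solutions : ∀ {B} → Respects B → ∀ x → count (λ y → B y ∧ (x + y) ≈ᵇ 1#) ≡ 𝟙 (B (1# - x))
  count-solutions {B} B-resp x =
    trans (count-cong (λ y → cong (B y ∧_) (does-⇔ (+≈1⇔≈1- x y) ((x + y) ≟ 1#) (y ≟ (1# - x)))))
          (count-point B-resp (1# - x))

  Class : Parity → Parity → Carrier → Bool
  Class s t x = nontrivial x ∧ (χ x ≡ᵇ s ∧ χ (1# - x) ≡ᵇ t)

  N : Parity → Parity → ℕ
  N s t = count (Class s t)

  Class-0 : ∀ s t → Class s t 0# ≡ false
  Class-0 s t = cong (_∧ (χ 0# ≡ᵇ s ∧ χ (1# - 0#) ≡ᵇ t)) nontrivial-0

  Class-1 : ∀ s t → Class s t 1# ≡ false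
  Class-1 s t = cong (_∧ (χ 1# ≡ᵇ s ∧ χ (1# - 1#) ≡ᵇ t)) nontrivial-1

  1-‿cong : ∀ {x y} → x ≈ y → 1# - x ≈ 1# - y
  1-‿cong x≈y = +-congˡ (-‿cong x≈y)

  nontrivial-respects : Respects nontrivial
  nontrivial-respects x≈y = cong₂ (λ a b → not a ∧ not b) (≈ᵇ-respects 0# x≈y) (≈ᵇ-respects 1# x≈y)

  Class-respects : ∀ s t → Respects (Class s t)
  Class-respects s t x≈y = cong₂ _∧_ (nontrivial-respects x≈y)
    (cong₂ (λ p p′ → p ≡ᵇ s ∧ p′ ≡ᵇ t) (χ-respects x≈y) (χ-respects (1-‿cong x≈y)))

  -- x ↦ 1 - x exchanges the classes (s, t) and (t, s).
  N-symmetric : ∀ s t → N s t ≡ N t s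
  N-symmetric s t =
    trans (count-involution (λ x → 1# - x) 1-‿cong 1-[1-x]≈x (Class-respects s t)) (count-cong swap)
    where
    swap : ∀ x → Class s t (1# - x) ≡ Class t s x
    swap x = cong₂ _∧_
      (begin
        not ((1# - x) ≈ᵇ 0#) ∧ not ((1# - x) ≈ᵇ 1#)
          ≡⟨ cong₂ (λ a b → not a ∧ not b) (does-⇔ (1-x≈0⇔x≈1 x) ((1# - x) ≟ 0#) (x ≟ 1#))
                                           (does-⇔ (1-x≈1⇔x≈0 x) ((1# - x) ≟ 1#) (x ≟ 0#)) ⟩
        not (x ≈ᵇ 1#) ∧ not (x ≈ᵇ 0#)
          ≡⟨ ∧-comm (not (x ≈ᵇ 1#)) _ ⟩
        nontrivial x ∎)
      (trans (cong (λ p → χ (1# - x) ≡ᵇ s ∧ p ≡ᵇ t) (χ-respects (1-[1-x]≈x x)))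
             (∧-comm (χ (1# - x) ≡ᵇ s) (χ x ≡ᵇ t)))

  N-row : ∀ s → count (λ x → nontrivial x ∧ χ x ≡ᵇ s) ≡ N s 0ℙ ℕ.+ N s 1ℙ
  N-row s = count-split _ (Class s 0ℙ) (Class s 1ℙ)
                        (λ x → split-by-parity (nontrivial x) (χ x ≡ᵇ s) (χ (1# - x)))

  -- If χ is multiplicative, x ↦ x⁻¹ maps the class (s, t) onto (s, t ⊕ (χ(-1) ⊕ s)),
  -- because χ(x⁻¹) = χ(x) and 1 - x⁻¹ = -1 · (1 - x) · x⁻¹.
  N-inversion : (∀ {u v} → ¬ u ≈ 0# → ¬ v ≈ 0# → χ (u * v) ≡ χ u ⊕ χ v) →
                ∀ s t → N s t ≡ N s (t ⊕ (χ (- 1#) ⊕ s))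
  N-inversion χ-* s t =
    trans (count-involution inv inv-cong inv-involutive (Class-respects s t)) (count-cong invert)
    where
    c : Parity
    c = χ (- 1#)

    χ-inv : ∀ {x} → ¬ x ≈ 0# → χ (inv x) ≡ χ x
    χ-inv {x} x≉0 = ⊕≡0⇒≡ (χ x) (χ (inv x))
      (trans (sym (χ-* x≉0 (inv-nonzero x≉0))) (trans (χ-respects (inv-inverse x≉0)) χ-one))

    χ-1-inv : ∀ {x} → ¬ x ≈ 0# → ¬ x ≈ 1# → χ (1# - inv x) ≡ χ (1# - x) ⊕ (c ⊕ χ x)
    χ-1-inv {x} x≉0 x≉1 = begin
      χ (1# - inv x)                    ≡⟨ χ-respects (1-inv x≉0) ⟩
      χ (- 1# * ((1# - x) * inv x))     ≡⟨ χ-* -1≉0 (nonzero-* 1-x≉0 (inv-nonzero x≉0)) ⟩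
      c ⊕ χ ((1# - x) * inv x)          ≡⟨ cong (c ⊕_) (χ-* 1-x≉0 (inv-nonzero x≉0)) ⟩
      c ⊕ (χ (1# - x) ⊕ χ (inv x))      ≡⟨ cong (λ p → c ⊕ (χ (1# - x) ⊕ p)) (χ-inv x≉0) ⟩
      c ⊕ (χ (1# - x) ⊕ χ x)            ≡⟨ x∙yz≈y∙xz c (χ (1# - x)) (χ x) ⟩
      χ (1# - x) ⊕ (c ⊕ χ x)            ∎
      where
      1-x≉0 : ¬ 1# - x ≈ 0#
      1-x≉0 = x≉1 ∘ Equivalence.to (1-x≈0⇔x≈1 x)

    nontrivial-inv : ∀ x → nontrivial (inv x) ≡ nontrivial x
    nontrivial-inv x = cong₂ (λ a b → not a ∧ not b)
      (does-⇔ (involution-fixed inv inv-cong inv-involutive (inv-zero FF.refl) x) (inv x ≟ 0#) (x ≟ 0#))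
      (does-⇔ (involution-fixed inv inv-cong inv-involutive inv-one x) (inv x ≟ 1#) (x ≟ 1#))

    invert : ∀ x → Class s t (inv x) ≡ Class s (t ⊕ (c ⊕ s)) x
    invert x = begin
      nontrivial (inv x) ∧ (χ (inv x) ≡ᵇ s ∧ χ (1# - inv x) ≡ᵇ t)
        ≡⟨ cong (_∧ (χ (inv x) ≡ᵇ s ∧ χ (1# - inv x) ≡ᵇ t)) (nontrivial-inv x) ⟩
      nontrivial x ∧ (χ (inv x) ≡ᵇ s ∧ χ (1# - inv x) ≡ᵇ t)
        ≡⟨ ∧-guard (λ nt → let (x≉0 , x≉1) = nontrivial⇒ nt in
                      cong₂ (λ p p′ → p ≡ᵇ s ∧ p′ ≡ᵇ t) (χ-inv x≉0) (χ-1-inv x≉0 x≉1)) ⟩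
      nontrivial x ∧ (χ x ≡ᵇ s ∧ (χ (1# - x) ⊕ (c ⊕ χ x)) ≡ᵇ t)
        ≡⟨ cong (nontrivial x ∧_) (shifted-condition (χ x) s (χ (1# - x)) c t) ⟩
      nontrivial x ∧ (χ x ≡ᵇ s ∧ χ (1# - x) ≡ᵇ (t ⊕ (c ⊕ s)))
        ∎

  -- The Golomb-Costas setting: generators α, β of F^* and q = 3 + 2r, so that the
  -- array has order n = q - 2 = 2r + 1 and F^* has even order 2r + 2.
  module Costas (α β : Carrier) (gα : IsGenerator F α) (gβ : IsGenerator F β)
                (r : ℕ) (q≡3+2r : q ≡ 3 ℕ.+ (r ℕ.+ r)) where

    n : ℕ
    n = suc (r ℕ.+ r)

    module A = Generator α gα
    module B = Generator β gβ

    order≡ : ∀ {γ} (g : IsGenerator F γ) → Generator.m γ g ≡ suc n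
    order≡ {γ} g = suc-injective (trans (Generator.1+order≡q γ g) q≡3+2r)

    order-even : ∀ {γ} (g : IsGenerator F γ) → parity (Generator.m γ g) ≡ 0ℙ
    order-even g = trans (cong parity (order≡ g)) (parity-double r)

    power-nontrivial : ∀ {γ} (g : IsGenerator F γ) (k : Fin n) → nontrivial (γ ^ suc (toℕ k)) ≡ true
    power-nontrivial {γ} g k = nontrivial-intro (^-nonzero (suc (toℕ k)) (Generator.γ≉0 γ g))
      (Generator.order-minimal γ g (s≤s z≤n) (subst (suc (toℕ k) ℕ.<_) (sym (order≡ g)) (s≤s (toℕ<n k))))

    χ-* : ∀ {u v} → ¬ u ≈ 0# → ¬ v ≈ 0# → χ (u * v) ≡ χ u ⊕ χ v
    χ-* = A.χ-* (order-even gα)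

    -- -1 = α^(r+1), so χ(-1) = parity (r + 1).
    χ-minus-one : χ (- 1#) ≡ parity (suc r)
    χ-minus-one = trans (χ-respects (FF.sym (A.^-half r (trans (order≡ gα) (cong suc (sym (+-suc r r)))))))
                        (A.χ-power (order-even gα) (suc r))

    count-character : ∀ s →
      count (λ x → nontrivial x ∧ χ x ≡ᵇ s) ≡ ∑[ k < n ] 𝟙 (parity (suc (toℕ k)) ≡ᵇ s)
    count-character s =
      trans (A.count-nontrivial (order≡ gα) f-resp (cong (_∧ (χ 0# ≡ᵇ s)) nontrivial-0)
                                                   (cong (_∧ (χ 1# ≡ᵇ s)) nontrivial-1))
            (sum-cong-≗ (λ k → cong 𝟙 (cong₂ _∧_ (power-nontrivial gα k)
                                                 (cong (_≡ᵇ s) (A.χ-power (order-even gα) (suc (toℕ k)))))))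
      where
      f-resp : Respects (λ x → nontrivial x ∧ χ x ≡ᵇ s)
      f-resp x≈y = cong₂ _∧_ (nontrivial-respects x≈y) (cong (_≡ᵇ s) (χ-respects x≈y))

    row-squares : N 0ℙ 0ℙ ℕ.+ N 0ℙ 1ℙ ≡ r
    row-squares =
      trans (sym (N-row 0ℙ)) (trans (count-character 0ℙ) (trans (count-evens n) (⌊2u+1/2⌋≡u r)))

    row-nonsquares : N 1ℙ 0ℙ ℕ.+ N 1ℙ 1ℙ ≡ suc r
    row-nonsquares =
      trans (sym (N-row 1ℙ)) (trans (count-character 1ℙ) (trans (count-odds n) (cong suc (⌊2u/2⌋≡u r))))

    inversion : ∀ s t → N s t ≡ N s (t ⊕ (parity (suc r) ⊕ s))
    inversion s t = trans (N-inversion χ-* s t) (cong (λ c → N s (t ⊕ (c ⊕ s))) χ-minus-one)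

    -- The dots of parity class (a, b): for each row i = k + 1 at most the column with
    -- β^j = 1 - α^i carries a dot, and it is in the class iff 1 - α^i has character parity b.
    module Dots {a b : ℕ} (a≤1 : a ℕ.≤ 1) (b≤1 : b ℕ.≤ 1) where

      I : List ℕ
      I = indices F

      pa pb : Parity
      pa = parity a
      pb = parity b

      dot : ℕ → ℕ → Bool
      dot i j = does (i % 2 ≟ℕ a) ∧ (does (j % 2 ≟ℕ b) ∧ (α ^ i + β ^ j) ≈ᵇ 1#)

      sum-indices : (f : ℕ → ℕ) → sum (map f I) ≡ ∑[ k < n ] f (suc (toℕ k))
      sum-indices f =
        trans (sum-positive f (q ∸ 2)) (cong (λ m → ∑[ k < m ] f (suc (toℕ k))) (cong (_∸ 2) q≡3+2r))

      module Row (k : Fin n) where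
        i : ℕ
        i = suc (toℕ k)
        x : Carrier
        x = α ^ i
        i-in-class : Bool
        i-in-class = parity i ≡ᵇ pa

        g : Carrier → Bool
        g y = i-in-class ∧ (χ y ≡ᵇ pb ∧ (x + y) ≈ᵇ 1#)

        g-resp : Respects g
        g-resp y≈y′ =
          cong₂ (λ p e → i-in-class ∧ (p ≡ᵇ pb ∧ e)) (χ-respects y≈y′) (≈ᵇ-respects 1# (+-congˡ y≈y′))

        column : ∀ j → dot i j ≡ g (β ^ j)
        column j = cong₂ (λ u v → u ∧ (v ∧ (x + β ^ j) ≈ᵇ 1#)) (%2-test i a≤1)
                         (trans (%2-test j b≤1) (cong (_≡ᵇ pb) (sym (B.χ-power (order-even gβ) j))))

        x≉0 : ¬ x ≈ 0#
        x≉0 = proj₁ (nontrivial⇒ (power-nontrivial gα k))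
        x≉1 : ¬ x ≈ 1#
        x≉1 = proj₂ (nontrivial⇒ (power-nontrivial gα k))

        off-line : ∀ y → ¬ (x + y) ≈ 1# → g y ≡ false
        off-line y x+y≉1 =
          trans (cong (λ e → i-in-class ∧ (χ y ≡ᵇ pb ∧ e)) (dec-false ((x + y) ≟ 1#) x+y≉1))
                (trans (cong (i-in-class ∧_) (∧-zeroʳ (χ y ≡ᵇ pb))) (∧-zeroʳ i-in-class))
        g-0 : g 0# ≡ false
        g-0 = off-line 0# (λ e → x≉1 (FF.trans (FF.sym (+-identityʳ x)) e))
        g-1 : g 1# ≡ false
        g-1 = off-line 1# (λ e → x≉0 (Equivalence.to (1-x≈1⇔x≈0 x)
                                        (FF.sym (Equivalence.to (+≈1⇔≈1- x 1#) e))))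

        class-value : Class pa pb x ≡ i-in-class ∧ χ (1# - x) ≡ᵇ pb
        class-value = cong₂ _∧_ (power-nontrivial gα k)
                                (cong (λ p → p ≡ᵇ pa ∧ χ (1# - x) ≡ᵇ pb) (A.χ-power (order-even gα) i))

        row : sum (map (λ j → 𝟙 (dot i j)) I) ≡ 𝟙 (Class pa pb x)
        row = begin
          sum (map (λ j → 𝟙 (dot i j)) I)
            ≡⟨ sum-indices (λ j → 𝟙 (dot i j)) ⟩
          ∑[ l < n ] 𝟙 (dot i (suc (toℕ l)))
            ≡⟨ sum-cong-≗ {n} (λ l → cong 𝟙 (column (suc (toℕ l)))) ⟩
          ∑[ l < n ] 𝟙 (g (β ^ suc (toℕ l)))
            ≡⟨ B.count-nontrivial (order≡ gβ) g-resp g-0 g-1 ⟨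
          count g
            ≡⟨ count-cong (λ y → sym (∧-assoc i-in-class (χ y ≡ᵇ pb) ((x + y) ≈ᵇ 1#))) ⟩
          count (λ y → (i-in-class ∧ χ y ≡ᵇ pb) ∧ (x + y) ≈ᵇ 1#)
            ≡⟨ count-solutions (λ y≈y′ → cong (λ p → i-in-class ∧ p ≡ᵇ pb) (χ-respects y≈y′)) x ⟩
          𝟙 (i-in-class ∧ χ (1# - x) ≡ᵇ pb)
            ≡⟨ cong 𝟙 class-value ⟨
          𝟙 (Class pa pb x)
            ∎

      dotCount≡N : dotCount F α β a b ≡ N pa pb
      dotCount≡N = begin
        dotCount F α β a b
          ≡⟨ length-filter _ (cartesianProduct I I) ⟩
        sum (map (λ (i , j) → 𝟙 (dot i j)) (cartesianProduct I I))
          ≡⟨ sum-cartesianProduct (λ (i , j) → 𝟙 (dot i j)) I I ⟩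
        sum (map (λ i → sum (map (λ j → 𝟙 (dot i j)) I)) I)
          ≡⟨ sum-indices (λ i → sum (map (λ j → 𝟙 (dot i j)) I)) ⟩
        ∑[ k < n ] sum (map (λ j → 𝟙 (dot (suc (toℕ k)) j)) I)
          ≡⟨ sum-cong-≗ {n} (λ k → Row.row k) ⟩
        ∑[ k < n ] 𝟙 (Class pa pb (α ^ suc (toℕ k)))
          ≡⟨ A.count-nontrivial (order≡ gα) (Class-respects pa pb) (Class-0 pa pb) (Class-1 pa pb) ⟨
        N pa pb
          ∎

module Arithmetic where
  open import Data.Nat.Base using (zero; suc; _+_; _*_; _%_; _/_; _≤_; s≤s)
  open import Data.Nat.Properties using (+-suc; suc-injective)
  open import Data.Nat.DivMod using (m≡m%n+[m/n]*n; m*n/n≡m)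
  open import Data.Product.Base using (∃; _,_)
  open import Data.Empty using (⊥; ⊥-elim)
  open import Relation.Binary.PropositionalEquality using (_≡_; refl; sym; trans; cong; subst)

  mod4≡1 : ∀ q → 2 ≤ q → q % 4 ≡ 1 → ∃ λ u → q ≡ 5 + u * 4
  mod4≡1 q 2≤q q%4≡1 with q / 4 | m≡m%n+[m/n]*n q 4
  ... | zero  | q≡ = ⊥-elim (2≰1 (subst (2 ≤_) (trans q≡ (cong (_+ 0) q%4≡1)) 2≤q))
    where
    2≰1 : 2 ≤ 1 → ⊥
    2≰1 (s≤s ())
  ... | suc u | q≡ = u , trans q≡ (cong (_+ suc u * 4) q%4≡1)

  mod4≡3 : ∀ q → q % 4 ≡ 3 → ∃ λ u → q ≡ 3 + u * 4
  mod4≡3 q q%4≡3 = q / 4 , trans (m≡m%n+[m/n]*n q 4) (cong (_+ (q / 4) * 4) q%4≡3)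

  quotient-by-4 : ∀ {x} v → x ≡ v * 4 → x / 4 ≡ v
  quotient-by-4 v x≡4v = trans (cong (_/ 4) x≡4v) (m*n/n≡m v 4)

  double-injective : ∀ {x y} → x + x ≡ y + y → x ≡ y
  double-injective {zero}  {zero}  _ = refl
  double-injective {zero}  {suc y} ()
  double-injective {suc x} {zero}  ()
  double-injective {suc x} {suc y} e =
    cong suc (double-injective (suc-injective (trans (sym (+-suc x x)) (trans (suc-injective e) (+-suc y y)))))

module Cases {q} (F : FiniteField q) (α β : FiniteField.Carrier F)
             (gα : IsGenerator F α) (gβ : IsGenerator F β) where
  open Arithmetic
  open QuadraticClasses F using (N; N-symmetric; module Costas)
  open import Data.Nat.Base using (suc; _+_; _*_; _∸_; _%_; _/_; z≤n; s≤s)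
  open import Data.Nat.Properties using (+-suc; +-comm; +-cancelʳ-≡; +-cancelˡ-≡)
  open import Data.Nat.Tactic.RingSolver using (solve-∀)
  open import Data.Parity.Base using (0ℙ; 1ℙ) renaming (_+_ to _⊕_)
  open import Data.Product.Base using (_×_; _,_)
  open import Relation.Binary.PropositionalEquality using (_≡_; sym; trans; cong)

  -- q ≡ 1 (mod 4): q = 5 + 4u, r = 2u + 1, and -1 is a square, so inversion gives N 1 0 = N 1 1.
  q≡1-mod-4 : q % 4 ≡ 1 →
    dotCount F α β 0 0 ≡ (q ∸ 5) / 4 × dotCount F α β 1 1 ≡ (q ∸ 1) / 4 ×
    dotCount F α β 0 1 ≡ (q ∸ 1) / 4 × dotCount F α β 1 0 ≡ (q ∸ 1) / 4
  q≡1-mod-4 q%4≡1 with (u , q≡5+4u) ← mod4≡1 q (FieldFacts.Generator.2≤q F α gα) q%4≡1 =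
    trans (Dots.dotCount≡N z≤n z≤n) (trans N00≡u (sym [q-5]/4≡u)) ,
    trans (Dots.dotCount≡N (s≤s z≤n) (s≤s z≤n)) (trans N11≡1+u (sym [q-1]/4≡1+u)) ,
    trans (Dots.dotCount≡N z≤n (s≤s z≤n)) (trans N01≡1+u (sym [q-1]/4≡1+u)) ,
    trans (Dots.dotCount≡N (s≤s z≤n) z≤n) (trans N10≡1+u (sym [q-1]/4≡1+u))
    where
    form : ∀ u → 5 + u * 4 ≡ 3 + (suc (u + u) + suc (u + u))
    form = solve-∀
    open Costas α β gα gβ (suc (u + u)) (trans q≡5+4u (form u))
    [q-5]/4≡u : (q ∸ 5) / 4 ≡ u
    [q-5]/4≡u = quotient-by-4 u (cong (_∸ 5) q≡5+4u)
    [q-1]/4≡1+u : (q ∸ 1) / 4 ≡ suc u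
    [q-1]/4≡1+u = quotient-by-4 (suc u) (cong (_∸ 1) q≡5+4u)
    N10≡N11 : N 1ℙ 0ℙ ≡ N 1ℙ 1ℙ
    N10≡N11 = trans (inversion 1ℙ 0ℙ) (cong (λ c → N 1ℙ (0ℙ ⊕ (c ⊕ 1ℙ))) (parity-double u))
    N11≡1+u : N 1ℙ 1ℙ ≡ suc u
    N11≡1+u = double-injective
      (trans (cong (_+ N 1ℙ 1ℙ) (sym N10≡N11)) (trans row-nonsquares (cong suc (sym (+-suc u u)))))
    N10≡1+u : N 1ℙ 0ℙ ≡ suc u
    N10≡1+u = trans N10≡N11 N11≡1+u
    N01≡1+u : N 0ℙ 1ℙ ≡ suc u
    N01≡1+u = trans (N-symmetric 0ℙ 1ℙ) N10≡1+u
    N00≡u : N 0ℙ 0ℙ ≡ u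
    N00≡u = +-cancelʳ-≡ (suc u) (N 0ℙ 0ℙ) u
      (trans (cong (N 0ℙ 0ℙ +_) (sym N01≡1+u)) (trans row-squares (sym (+-suc u u))))

  -- q ≡ 3 (mod 4): q = 3 + 4u, r = 2u, and -1 is a non-square, so inversion gives N 0 0 = N 0 1.
  q≡3-mod-4 : q % 4 ≡ 3 →
    dotCount F α β 0 0 ≡ (q ∸ 3) / 4 × dotCount F α β 0 1 ≡ (q ∸ 3) / 4 ×
    dotCount F α β 1 0 ≡ (q ∸ 3) / 4 × dotCount F α β 1 1 ≡ (q + 1) / 4
  q≡3-mod-4 q%4≡3 with (u , q≡3+4u) ← mod4≡3 q q%4≡3 =
    trans (Dots.dotCount≡N z≤n z≤n) (trans N00≡u (sym [q-3]/4≡u)) ,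
    trans (Dots.dotCount≡N z≤n (s≤s z≤n)) (trans N01≡u (sym [q-3]/4≡u)) ,
    trans (Dots.dotCount≡N (s≤s z≤n) z≤n) (trans N10≡u (sym [q-3]/4≡u)) ,
    trans (Dots.dotCount≡N (s≤s z≤n) (s≤s z≤n)) (trans N11≡1+u (sym [q+1]/4≡1+u))
    where
    form : ∀ u → 3 + u * 4 ≡ 3 + ((u + u) + (u + u))
    form = solve-∀
    open Costas α β gα gβ (u + u) (trans q≡3+4u (form u))
    [q-3]/4≡u : (q ∸ 3) / 4 ≡ u
    [q-3]/4≡u = quotient-by-4 u (cong (_∸ 3) q≡3+4u)
    [q+1]/4≡1+u : (q + 1) / 4 ≡ suc u
    [q+1]/4≡1+u = quotient-by-4 (suc u) (trans (+-comm q 1) (cong suc q≡3+4u))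
    N00≡N01 : N 0ℙ 0ℙ ≡ N 0ℙ 1ℙ
    N00≡N01 = trans (inversion 0ℙ 0ℙ) (cong (λ c → N 0ℙ (0ℙ ⊕ (c ⊕ 0ℙ))) (parity-odd u))
    N00≡u : N 0ℙ 0ℙ ≡ u
    N00≡u = double-injective (trans (cong (N 0ℙ 0ℙ +_) N00≡N01) row-squares)
    N01≡u : N 0ℙ 1ℙ ≡ u
    N01≡u = trans (sym N00≡N01) N00≡u
    N10≡u : N 1ℙ 0ℙ ≡ u
    N10≡u = trans (N-symmetric 1ℙ 0ℙ) N01≡u
    N11≡1+u : N 1ℙ 1ℙ ≡ suc u
    N11≡1+u = +-cancelˡ-≡ u (N 1ℙ 1ℙ) (suc u)
      (trans (cong (_+ N 1ℙ 1ℙ) (sym N10≡u)) (trans row-nonsquares (sym (+-suc u u))))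

open import Data.Nat.Base using (ℕ; suc; _∸_; _+_; _%_; _/_; _^_)
open import Data.Nat.Primality using (Prime)
open import Data.Product.Base using (∃; _×_; _,_)
open import Relation.Binary.PropositionalEquality using (_≡_)

theorem9 : (q : ℕ) → (∃ λ p → ∃ λ k → Prime p × p % 2 ≡ 1 × q ≡ p ^ suc k) →
           (F : FiniteField q) → (α β : FiniteField.Carrier F) →
           IsGenerator F α → IsGenerator F β →
           (q % 4 ≡ 1 →
             dotCount F α β 0 0 ≡ (q ∸ 5) / 4 ×
             dotCount F α β 1 1 ≡ (q ∸ 1) / 4 ×
             dotCount F α β 0 1 ≡ (q ∸ 1) / 4 ×
             dotCount F α β 1 0 ≡ (q ∸ 1) / 4)
           ×
           (q % 4 ≡ 3 →
             dotCount F α β 0 0 ≡ (q ∸ 3) / 4 ×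
             dotCount F α β 0 1 ≡ (q ∸ 3) / 4 ×
             dotCount F α β 1 0 ≡ (q ∸ 3) / 4 ×
             dotCount F α β 1 1 ≡ (q + 1) / 4)
theorem9 q _ F α β gα gβ = q≡1-mod-4 , q≡3-mod-4
  where open Cases F α β gα gβ
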